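{- Let $k\ge 1$ and let $u=(u_k,\dots,u_2,u_1)$ be a vector of nonnegative integers that is a step vector, i.e. $u_1=1$ and $u_{i+1}-u_i\in\{0,1\}$ for $i=1,\dots,k-1$. Then $u$ is spanning: for every integer $b$ with $0\le b\le uu^T=\sum_{i=1}^k u_i^2$ there exists a vector $v=(v_k,\dots,v_1)$ of nonnegative integers with $v\le u$ (entrywise) and $vu^T=\sum_{i=1}^k v_iu_i=b$.
   Context: All numbers, vectors and matrices are nonnegative integers. For vectors $u,v$ of the same length, $vu^T=\sum_i v_iu_i$ and $v\le u$ means $v_i\le u_i$ for all $i$. -}

module Defs where

open import Data.Nat using (ℕ; zero; suc; _+_; _*_; _≤_)
open import Data.Fin using (Fin; zero; suc; toℕ)
open import Data.Sum using (_⊎_)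
import Data.Fin
import Data.Product
open import Relation.Binary.PropositionalEquality using (_≡_)

-- Vectors of length k are functions Fin k → ℕ; index i (0-based) stands for
-- the paper's u_{i+1}, so u_1 is  u zero.

∑ : ∀ {k} → (Fin k → ℕ) → ℕ
∑ {zero}  f = 0
∑ {suc k} f = f zero + ∑ (λ i → f (suc i))

_·_ : ∀ {k} → (Fin k → ℕ) → (Fin k → ℕ) → ℕ
v · u = ∑ (λ i → v i * u i)

_≤ᵥ_ : ∀ {k} → (Fin k → ℕ) → (Fin k → ℕ) → Set
v ≤ᵥ u = ∀ i → v i ≤ u i

-- step vector: u_1 = 1 and u_{i+1} - u_i ∈ {0,1} for i = 1..k-1
-- (k ≥ 1 is built in by the length suc k)
record IsStep {k : ℕ} (u : Fin (suc k) → ℕ) : Set where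
  field
    first : u zero ≡ 1
    step  : ∀ (i : Fin k) → (u (suc i) ≡ u (Data.Fin.inject₁ i)) ⊎ (u (suc i) ≡ suc (u (Data.Fin.inject₁ i)))

Spanning : ∀ {k} → (Fin k → ℕ) → Set
Spanning u = ∀ (b : ℕ) → b ≤ u · u → Data.Product.∃ λ v → v ≤ᵥ u Data.Product.× v · u ≡ b

-- Scan u from u₁ upwards, keeping T, the sum of squares of the entries already
-- passed. A step vector satisfies u_{i+1} ≤ 1 + u_i ≤ 1 + T, and under that
-- growth bound alone, every b ≤ T + (rest)·(rest) is c + v·(rest) with c ≤ T:
-- the multiples 0, w, …, w·w of the next entry w, each widened by [0, T],
-- leave no gap in [0, T + w·w] because w ≤ T + 1. At the end T = 0 forces c = 0.
module Submission where

open import Defs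
open import Data.Nat using (ℕ; zero; suc; _+_; _*_; _∸_; _≤_; z≤n; s≤s; _≤?_)
open import Data.Nat.Properties
open import Data.Fin using (Fin; zero; suc; inject₁)
open import Data.Vec.Functional using (_∷_; tail)
open import Data.Product using (∃₂; _×_; _,_)
open import Data.Sum using (inj₁; inj₂)
open import Data.Unit using (⊤; tt)
open import Relation.Nullary using (yes; no)
open import Relation.Binary.PropositionalEquality

n≤n*n : ∀ n → n ≤ n * n
n≤n*n zero    = z≤n
n≤n*n (suc n) = m≤m*n (suc n) (suc n)

split-≤+* : ∀ m {T w c} → w ≤ suc T → c ≤ T + m * w →
            ∃₂ λ r q → r ≤ T × q ≤ m × r + q * w ≡ c
split-≤+* zero {T} {c = c} _ c≤ =
  c , 0 , subst (c ≤_) (+-identityʳ T) c≤ , z≤n , +-identityʳ c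
split-≤+* (suc m) {T} {w} {c} w≤1+T c≤ with c ≤? T
... | yes c≤T = c , 0 , c≤T , z≤n , +-identityʳ c
... | no c≰T =
  let r , q , r≤T , q≤m , r+qw≡c∸w = split-≤+* m w≤1+T c∸w≤
  in  r , suc q , r≤T , s≤s q≤m , (begin
        r + (w + q * w)  ≡⟨ +-assoc r w (q * w) ⟨
        r + w + q * w    ≡⟨ cong (_+ q * w) (+-comm r w) ⟩
        w + r + q * w    ≡⟨ +-assoc w r (q * w) ⟩
        w + (r + q * w)  ≡⟨ cong (w +_) r+qw≡c∸w ⟩
        w + (c ∸ w)      ≡⟨ m+[n∸m]≡n w≤c ⟩
        c                ∎)
  where
    open ≡-Reasoning
    w≤c : w ≤ c
    w≤c = ≤-trans w≤1+T (≰⇒> c≰T)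
    c∸w≤ : c ∸ w ≤ T + m * w
    c∸w≤ = ≤-trans (∸-monoˡ-≤ w c≤) (≤-reflexive (begin
      T + (w + m * w) ∸ w  ≡⟨ +-∸-assoc T (m≤m+n w (m * w)) ⟩
      T + (w + m * w ∸ w)  ≡⟨ cong (T +_) (m+n∸m≡n w (m * w)) ⟩
      T + m * w            ∎))

Admissible : ℕ → ∀ {n} → (Fin n → ℕ) → Set
Admissible T {zero}  w = ⊤
Admissible T {suc n} w = w zero ≤ suc T × Admissible (T + w zero * w zero) (tail w)

Covers : ℕ → ∀ {n} → (Fin n → ℕ) → Set
Covers T w = ∀ b → b ≤ T + w · w → ∃₂ λ c v → c ≤ T × v ≤ᵥ w × c + v · w ≡ b

admissible⇒covers : ∀ {n} T (w : Fin n → ℕ) → Admissible T w → Covers T w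
admissible⇒covers {zero} T w _ b b≤ =
  b , (λ ()) , subst (b ≤_) (+-identityʳ T) b≤ , (λ ()) , +-identityʳ b
admissible⇒covers {suc n} T w (w₀≤1+T , adm) b b≤ =
  let c′ , v′ , c′≤ , v′≤ , c′+v′w≡b = admissible⇒covers (T + w₀ * w₀) (tail w) adm b
                                         (subst (b ≤_) (sym (+-assoc T (w₀ * w₀) _)) b≤)
      c , q , c≤T , q≤w₀ , c+qw₀≡c′ = split-≤+* w₀ w₀≤1+T c′≤
  in  c , q ∷ v′ , c≤T , ≤ᵥ-cons q≤w₀ v′≤ , (begin
        c + (q * w₀ + v′ · tail w)  ≡⟨ +-assoc c (q * w₀) _ ⟨
        c + q * w₀ + v′ · tail w    ≡⟨ cong (_+ v′ · tail w) c+qw₀≡c′ ⟩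
        c′ + v′ · tail w            ≡⟨ c′+v′w≡b ⟩
        b                           ∎)
  where
    open ≡-Reasoning
    w₀ : ℕ
    w₀ = w zero
    ≤ᵥ-cons : ∀ {q v′} → q ≤ w₀ → v′ ≤ᵥ tail w → (q ∷ v′) ≤ᵥ w
    ≤ᵥ-cons q≤ _   zero    = q≤
    ≤ᵥ-cons _  v′≤ (suc i) = v′≤ i

covers-0⇒spanning : ∀ {n} (w : Fin n → ℕ) → Covers 0 w → Spanning w
covers-0⇒spanning w cov b b≤ with cov b b≤
... | zero , v , _ , v≤w , v·w≡b = v , v≤w , v·w≡b

-- p is the entry preceding u zero, and T the sum of squares up to and including it.
growth≤1⇒admissible : ∀ k (u : Fin (suc k) → ℕ) {p T} → p ≤ T → u zero ≤ suc p →
                      (∀ i → u (suc i) ≤ suc (u (inject₁ i))) → Admissible T u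
growth≤1⇒admissible zero    u p≤T u₀≤ _    = ≤-trans u₀≤ (s≤s p≤T) , tt
growth≤1⇒admissible (suc k) u {T = T} p≤T u₀≤ grow =
  ≤-trans u₀≤ (s≤s p≤T) ,
  growth≤1⇒admissible k (tail u) (≤-trans (n≤n*n (u zero)) (m≤n+m _ T))
    (grow zero) (λ i → grow (suc i))

step⇒growth≤1 : ∀ {k} {u : Fin (suc k) → ℕ} → IsStep u →
                ∀ i → u (suc i) ≤ suc (u (inject₁ i))
step⇒growth≤1 st i with IsStep.step st i
... | inj₁ same = ≤-trans (≤-reflexive same) (n≤1+n _)
... | inj₂ next = ≤-reflexive next

lemma1 : ∀ (k : ℕ) (u : Fin (suc k) → ℕ) → IsStep u → Spanning u
lemma1 k u st = covers-0⇒spanning u (admissible⇒covers 0 u admissible)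
  where
    admissible : Admissible 0 u
    admissible = growth≤1⇒admissible k u z≤n (≤-reflexive (IsStep.first st))
                   (step⇒growth≤1 st)
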